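{- Let $n\ge 3$ and let $P(G(n))$ be the power graph of the gyrogroup $(G(n),\oplus)$ described in the context. Then $dis(P(G(n)),0)=2^n$, $dis(P(G(n)),1)=\frac{2^{n-1}(2^{n-1}+1)}{2}$ and $dis(P(G(n)),2)=\frac{3\cdot 2^{n-1}(2^{n-1}-1)}{2}$.
   Context: Let $n\ge 3$ and $m=2^{n-1}$. Put $P(n)=\{0,1,\dots,m-1\}$, $H(n)=\{m,m+1,\dots,2^n-1\}$ and $G(n)=P(n)\cup H(n)$. Define a binary operation $\oplus$ on $G(n)$ by: $i\oplus j=t$ if $(i,j)\in P(n)\times P(n)$; $i\oplus j=t+m$ if $(i,j)\in P(n)\times H(n)$; $i\oplus j=s+m$ if $(i,j)\in H(n)\times P(n)$; $i\oplus j=k$ if $(i,j)\in H(n)\times H(n)$, where $t,s,k\in P(n)$ are determined by $t\equiv i+j$, $s\equiv i+(\tfrac m2-1)j$, $k\equiv(\tfrac m2+1)i+(\tfrac m2-1)j \pmod m$. Then $(G(n),\oplus)$ is a gyrogroup with identity $e=0$. Powers are defined by $a^1=a$, $a^{k+1}=a\oplus a^k$. The power graph $P(G(n))$ is the simple undirected graph with vertex set $G(n)$ in which two distinct vertices $u,v$ are adjacent if and only if $u^k=v$ or $v^k=u$ for some positive integer $k$. For a connected graph $G$ and integer $i\ge 0$, $dis(G,i)$ denotes the number of unordered pairs $\{u,v\}$ of (not necessarily distinct) vertices with $d(u,v)=i$, where $d$ is the shortest-path distance. -}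

module Defs where

open import Data.Nat using (ℕ; zero; suc; _+_; _*_; _∸_; _^_; _≤_; _<_; NonZero)
open import Data.Nat.DivMod using (_%_; _/_)
open import Data.Nat.Properties using (m^n≢0)
open import Data.Product using (Σ; _×_; _,_; ∃)
open import Data.Sum using (_⊎_)
open import Data.List using (List; length)
open import Data.List.Membership.Propositional using (_∈_)
open import Data.List.Relation.Unary.Unique.Propositional using (Unique)
open import Function.Bundles using (_⇔_)
open import Relation.Binary.PropositionalEquality using (_≡_; _≢_)
open import Relation.Nullary using (¬_)
open import Data.Bool using (if_then_else_)
open import Relation.Nullary.Decidable using (⌊_⌋)
open import Data.Nat using (_<?_)

half : ℕ → ℕ
half n = 2 ^ (n ∸ 1)

half-nonZero : ∀ n → NonZero (half n)
half-nonZero n = m^n≢0 2 (n ∸ 1)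

modm : ℕ → ℕ → ℕ
modm n x = _%_ x (half n) {{half-nonZero n}}

-- G(n) = {0, ..., 2^n - 1}; P(n) = {i | i < m}, H(n) = {i | m ≤ i < 2^n}
InG : ℕ → ℕ → Set
InG n x = x < 2 ^ n

oplus : ℕ → ℕ → ℕ → ℕ
oplus n i j =
  if ⌊ i <? m ⌋
  then (if ⌊ j <? m ⌋
        then modm n (i + j)
        else modm n (i + j) + m)
  else (if ⌊ j <? m ⌋
        then modm n (i + (m / 2 ∸ 1) * j) + m
        else modm n ((m / 2 + 1) * i + (m / 2 ∸ 1) * j))
  where m = half n

-- powS n a k = a^(k+1) where a^1 = a, a^(k+1) = a ⊕ a^k
powS : ℕ → ℕ → ℕ → ℕ
powS n a zero = a
powS n a (suc k) = oplus n a (powS n a k)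

IsPowerOf : ℕ → ℕ → ℕ → Set
IsPowerOf n u v = ∃ λ k → powS n u k ≡ v

Adj : ℕ → ℕ → ℕ → Set
Adj n u v = InG n u × InG n v × u ≢ v × (IsPowerOf n u v ⊎ IsPowerOf n v u)

data Walk (n : ℕ) : ℕ → ℕ → ℕ → Set where
  here : ∀ {u} → InG n u → Walk n u u zero
  step : ∀ {u w v k} → Adj n u w → Walk n w v k → Walk n u v (suc k)

Dist : ℕ → ℕ → ℕ → ℕ → Set
Dist n i u v = Walk n u v i × (∀ j → j < i → ¬ Walk n u v j)

HasSize : ℕ → (ℕ × ℕ → Set) → Set
HasSize N P = Σ (List (ℕ × ℕ)) λ L → Unique L × length L ≡ N × (∀ x → (x ∈ L) ⇔ P x)

-- unordered pairs {u,v} (u = v allowed) of vertices of G(n), encoded as (u,v) with u ≤ v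
AtDist : ℕ → ℕ → ℕ × ℕ → Set
AtDist n i (u , v) = u ≤ v × InG n u × InG n v × Dist n i u v

dis≡ : ℕ → ℕ → ℕ → Set
dis≡ n i N = HasSize N (AtDist n i)

-- P(n) is the cyclic group ℤ/2^(n-1), and in a cyclic group of prime-power order the
-- subgroups form a chain (the subgroup generated by a is the one generated by gcd(a, M),
-- a divisor of M), so any two elements of P(n) are powers of one another: P(n) is a
-- clique. An element h of H(n) satisfies h ⊕ h = 0 and h ⊕ 0 = h, so its only powers are
-- h and 0: it is a pendant vertex attached to 0. The power graph is therefore the clique
-- K_m with m pendant vertices at 0; its edges number m(m-1)/2 + m, and every other pair of
-- distinct vertices is at distance 2 through 0.
module Submission where

open import Defs
open import Data.Bool using (if_then_else_)
open import Data.List using ([]; _∷_; _++_)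
open import Data.List.Properties using (length-++)
open import Data.List.Membership.Propositional using (_∈_)
open import Data.List.Membership.Propositional.Properties using (∈-++⁺ˡ; ∈-++⁺ʳ; ∈-++⁻)
open import Data.List.Relation.Unary.Any using (here)
import Data.List.Relation.Unary.All as All
open import Data.List.Relation.Unary.AllPairs using ([]; _∷_)
import Data.List.Relation.Unary.Unique.Propositional.Properties as Unique
open import Data.Nat
open import Data.Nat.Coprimality using (Coprime; coprime-divisor)
open import Data.Nat.Divisibility
open import Data.Nat.DivMod
open import Data.Nat.GCD
open import Data.Nat.Primality using (Prime; prime⇒irreducible; prime⇒nonZero; prime[2])
open import Data.Nat.Properties
open import Data.Nat.Tactic.RingSolver using (solve; solve-∀)
open import Data.Product using (_×_; _,_; ∃-syntax)
open import Data.Sum using (_⊎_; inj₁; inj₂; [_,_]′)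
import Data.Sum as Sum
open import Function using (_∘_; case_of_)
open import Function.Bundles using (_⇔_; mk⇔; Equivalence)
open import Function.Construct.Composition using (_⇔-∘_)
open import Function.Construct.Symmetry using (⇔-sym)
open import Relation.Nullary using (¬_; Dec; yes; no; contradiction)
open import Relation.Nullary.Decidable using (⌊_⌋)
open import Relation.Binary.PropositionalEquality

-- Divisors of prime powers and linear congruences

module _ {p : ℕ} (prime : Prime p) where

  private instance
    p≢0 : NonZero p
    p≢0 = prime⇒nonZero prime

  ∤⇒coprime : ∀ {d} → ¬ p ∣ d → Coprime d p
  ∤⇒coprime p∤d (c∣d , c∣p) with prime⇒irreducible prime c∣p
  ... | inj₁ c≡1 = c≡1
  ... | inj₂ refl = contradiction c∣d p∤d

  ∣p^⇒≡p^ : ∀ e {d} → d ∣ p ^ e → ∃[ i ] d ≡ p ^ i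
  ∣p^⇒≡p^ zero    d∣1 = 0 , ∣1⇒≡1 d∣1
  ∣p^⇒≡p^ (suc e) {d} d∣p^1+e with p ∣? d
  ... | no p∤d = ∣p^⇒≡p^ e (coprime-divisor (∤⇒coprime p∤d) d∣p^1+e)
  ... | yes (divides q refl)
    with ∣p^⇒≡p^ e {q} (*-cancelʳ-∣ p (subst (q * p ∣_) (*-comm p (p ^ e)) d∣p^1+e))
  ...   | i , refl = suc i , *-comm (p ^ i) p

  p^-mono-∣ : ∀ {i j} → i ≤ j → p ^ i ∣ p ^ j
  p^-mono-∣ {i} {j} i≤j = divides (p ^ (j ∸ i)) (begin
    p ^ j               ≡⟨ cong (p ^_) (m+[n∸m]≡n i≤j) ⟨
    p ^ (i + (j ∸ i))   ≡⟨ ^-distribˡ-+-* p i (j ∸ i) ⟩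
    p ^ i * p ^ (j ∸ i) ≡⟨ *-comm (p ^ i) _ ⟩
    p ^ (j ∸ i) * p ^ i ∎)
    where open ≡-Reasoning

  ∣p^-total : ∀ e {d d′} → d ∣ p ^ e → d′ ∣ p ^ e → d ∣ d′ ⊎ d′ ∣ d
  ∣p^-total e d∣p^e d′∣p^e with ∣p^⇒≡p^ e d∣p^e | ∣p^⇒≡p^ e d′∣p^e
  ... | i , refl | j , refl = Sum.map p^-mono-∣ p^-mono-∣ (≤-total i j)

m+kn≡o+ln⇒m%n≡o%n : ∀ n .{{_ : NonZero n}} m k o l → m + k * n ≡ o + l * n → m % n ≡ o % n
m+kn≡o+ln⇒m%n≡o%n n m k o l eq = begin
  m % n           ≡⟨ [m+kn]%n≡m%n m k n ⟨
  (m + k * n) % n ≡⟨ cong (_% n) eq ⟩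
  (o + l * n) % n ≡⟨ [m+kn]%n≡m%n o l n ⟩
  o % n           ∎
  where open ≡-Reasoning

[m+n%d]%d≡[m+n]%d : ∀ m n d .{{_ : NonZero d}} → (m + n % d) % d ≡ (m + n) % d
[m+n%d]%d≡[m+n]%d m n d = begin
  (m + n % d) % d           ≡⟨ %-distribˡ-+ m (n % d) d ⟩
  (m % d + n % d % d) % d   ≡⟨ cong (λ z → (m % d + z) % d) (m%n%n≡m%n n d) ⟩
  (m % d + n % d) % d       ≡⟨ %-distribˡ-+ m n d ⟨
  (m + n) % d               ∎
  where open ≡-Reasoning

bézout⇒congruence-solvable : ∀ {d a} M .{{_ : NonZero M}} c → Bézout.Identity d a M →
                             ∃[ t ] (t * a) % M ≡ (c * d) % M
bézout⇒congruence-solvable {d} {a} M@(suc w) c (Bézout.+- x y d+yM≡xa) =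
  c * x , m+kn≡o+ln⇒m%n≡o%n M (c * x * a) 0 (c * d) (c * y) (begin
    c * x * a + 0 * M   ≡⟨ solve (c ∷ x ∷ a ∷ w ∷ []) ⟩
    c * (x * a)         ≡⟨ cong (c *_) d+yM≡xa ⟨
    c * (d + y * M)     ≡⟨ solve (c ∷ d ∷ y ∷ w ∷ []) ⟩
    c * d + c * y * M   ∎)
  where open ≡-Reasoning
-- Here x a ≡ -d (mod M), so the multiplier is the negative -c x ≡ c x (M - 1)
bézout⇒congruence-solvable {d} {a} M@(suc w) c (Bézout.-+ x y d+xa≡yM) =
  c * x * w , m+kn≡o+ln⇒m%n≡o%n M (c * x * w * a) (c * y) (c * d) (c * x * a) (begin
    c * x * w * a + c * y * M        ≡⟨ solve (c ∷ x ∷ w ∷ a ∷ y ∷ []) ⟩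
    c * x * w * a + c * (y * M)      ≡⟨ cong (λ z → c * x * w * a + c * z) d+xa≡yM ⟨
    c * x * w * a + c * (d + x * a)  ≡⟨ solve (c ∷ x ∷ w ∷ a ∷ d ∷ []) ⟩
    c * d + c * x * a * M            ∎)
  where open ≡-Reasoning

gcd∣⇒congruence-solvable : ∀ M .{{_ : NonZero M}} a b → gcd a M ∣ b → ∃[ t ] (t * a) % M ≡ b % M
gcd∣⇒congruence-solvable M a _ (divides c refl) =
  bézout⇒congruence-solvable M c (Bézout.identity (gcd-GCD a M))

module _ {p : ℕ} (prime : Prime p) (e : ℕ) where

  private instance
    p^e≢0 : NonZero (p ^ e)
    p^e≢0 = m^n≢0 p e {{prime⇒nonZero prime}}

  multiples-total-mod-p^ : ∀ a b →
    (∃[ t ] (t * a) % p ^ e ≡ b % p ^ e) ⊎ (∃[ t ] (t * b) % p ^ e ≡ a % p ^ e)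
  multiples-total-mod-p^ a b =
    Sum.map (λ ga∣gb → gcd∣⇒congruence-solvable (p ^ e) a b (∣-trans ga∣gb (gcd[m,n]∣m b (p ^ e))))
            (λ gb∣ga → gcd∣⇒congruence-solvable (p ^ e) b a (∣-trans gb∣ga (gcd[m,n]∣m a (p ^ e))))
            (∣p^-total prime e (gcd[m,n]∣n a (p ^ e)) (gcd[m,n]∣n b (p ^ e)))

-- Counting sets of pairs

private variable
  A B N : ℕ
  P Q : ℕ × ℕ → Set

HasSize-⇔ : (∀ {u v} → P (u , v) ⇔ Q (u , v)) → HasSize N Q → HasSize N P
HasSize-⇔ P⇔Q (L , unique , length≡ , ∈⇔Q) = L , unique , length≡ , λ x → ⇔-sym P⇔Q ⇔-∘ ∈⇔Q x

HasSize-∅ : (∀ x → ¬ P x) → HasSize 0 P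
HasSize-∅ ¬P = [] , [] , refl , λ x → mk⇔ (λ ()) (λ Px → contradiction Px (¬P x))

HasSize-singleton : ∀ y → HasSize 1 (_≡ y)
HasSize-singleton y = y ∷ [] , All.[] ∷ [] , refl , λ x → mk⇔ (λ { (here x≡y) → x≡y }) here

HasSize-⊎ : (∀ {x} → P x → ¬ Q x) → HasSize A P → HasSize B Q → HasSize (A + B) (λ x → P x ⊎ Q x)
HasSize-⊎ {P = P} {Q = Q} P⇒¬Q (L , uL , refl , ∈L⇔) (K , uK , refl , ∈K⇔) =
  L ++ K , Unique.++⁺ uL uK disjoint , length-++ L , λ x → mk⇔ (to x) (from x)
  where
  disjoint : ∀ {x} → ¬ (x ∈ L × x ∈ K)
  disjoint {x} (x∈L , x∈K) = P⇒¬Q (Equivalence.to (∈L⇔ x) x∈L) (Equivalence.to (∈K⇔ x) x∈K)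
  to : ∀ x → x ∈ L ++ K → P x ⊎ Q x
  to x x∈ = Sum.map (Equivalence.to (∈L⇔ x)) (Equivalence.to (∈K⇔ x)) (∈-++⁻ L x∈)
  from : ∀ x → P x ⊎ Q x → x ∈ L ++ K
  from x = [ ∈-++⁺ˡ ∘ Equivalence.from (∈L⇔ x) , ∈-++⁺ʳ L ∘ Equivalence.from (∈K⇔ x) ]′

InInterval : ℕ → ℕ → ℕ → Set
InInterval b l v = b ≤ v × v < b + l

Diagonal : ℕ → ℕ × ℕ → Set
Diagonal k (u , v) = u ≡ v × v < k

Row : ℕ → ℕ → ℕ → ℕ × ℕ → Set
Row a b l (u , v) = u ≡ a × InInterval b l v

Rectangle : ℕ → ℕ → ℕ → ℕ → ℕ × ℕ → Set
Rectangle a k b l (u , v) = InInterval a k u × InInterval b l v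

Triangle : ℕ → ℕ → ℕ × ℕ → Set
Triangle a k (u , v) = a ≤ u × u < v × v < a + k

triangle : ℕ → ℕ
triangle zero    = 0
triangle (suc k) = k + triangle k

<-+-suc : ∀ {v} a k → v < a + suc k → v < suc a + k
<-+-suc {v} a k = subst (v <_) (+-suc a k)

<-suc-+ : ∀ {v} a k → v < suc a + k → v < a + suc k
<-suc-+ {v} a k = subst (v <_) (sym (+-suc a k))

¬InInterval-0 : ∀ {b v} → ¬ InInterval b 0 v
¬InInterval-0 {b} {v} (b≤v , v<b+0) = <-irrefl refl (≤-<-trans b≤v (subst (v <_) (+-identityʳ b) v<b+0))

inInterval-suc : ∀ b l v → InInterval b (suc l) v ⇔ (v ≡ b ⊎ InInterval (suc b) l v)
inInterval-suc b l v = mk⇔ to from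
  where
  to : InInterval b (suc l) v → v ≡ b ⊎ InInterval (suc b) l v
  to (b≤v , v<) with b ≟ v
  ... | yes refl = inj₁ refl
  ... | no b≢v   = inj₂ (≤∧≢⇒< b≤v b≢v , <-+-suc b l v<)
  from : v ≡ b ⊎ InInterval (suc b) l v → InInterval b (suc l) v
  from (inj₁ refl)       = ≤-refl , <-suc-+ b l (s≤s (m≤m+n b l))
  from (inj₂ (b<v , v<)) = <⇒≤ b<v , <-suc-+ b l v<

HasSize-Diagonal : ∀ k → HasSize k (Diagonal k)
HasSize-Diagonal zero    = HasSize-∅ λ { (u , v) (_ , ()) }
HasSize-Diagonal (suc k) =
  HasSize-⇔ split (HasSize-⊎ disjoint (HasSize-singleton (k , k)) (HasSize-Diagonal k))
  where
  disjoint : ∀ {x} → x ≡ (k , k) → ¬ Diagonal k x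
  disjoint refl (_ , k<k) = <-irrefl refl k<k
  split : ∀ {u v} → Diagonal (suc k) (u , v) ⇔ ((u , v) ≡ (k , k) ⊎ Diagonal k (u , v))
  split {u} {v} = mk⇔ to from
    where
    to : Diagonal (suc k) (u , v) → (u , v) ≡ (k , k) ⊎ Diagonal k (u , v)
    to (refl , v<1+k) with v ≟ k
    ... | yes refl = inj₁ refl
    ... | no v≢k   = inj₂ (refl , ≤∧≢⇒< (s≤s⁻¹ v<1+k) v≢k)
    from : (u , v) ≡ (k , k) ⊎ Diagonal k (u , v) → Diagonal (suc k) (u , v)
    from (inj₁ refl)        = refl , ≤-refl
    from (inj₂ (u≡v , v<k)) = u≡v , m<n⇒m<1+n v<k

HasSize-Row : ∀ a b l → HasSize l (Row a b l)
HasSize-Row a b zero    = HasSize-∅ λ { (u , v) (_ , v∈) → ¬InInterval-0 v∈ }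
HasSize-Row a b (suc l) =
  HasSize-⇔ split (HasSize-⊎ disjoint (HasSize-singleton (a , b)) (HasSize-Row a (suc b) l))
  where
  disjoint : ∀ {x} → x ≡ (a , b) → ¬ Row a (suc b) l x
  disjoint refl (_ , b<b , _) = <-irrefl refl b<b
  split : ∀ {u v} → Row a b (suc l) (u , v) ⇔ ((u , v) ≡ (a , b) ⊎ Row a (suc b) l (u , v))
  split {u} {v} = mk⇔ to from
    where
    to : Row a b (suc l) (u , v) → (u , v) ≡ (a , b) ⊎ Row a (suc b) l (u , v)
    to (refl , v∈) with Equivalence.to (inInterval-suc b l v) v∈
    ... | inj₁ refl = inj₁ refl
    ... | inj₂ v∈′  = inj₂ (refl , v∈′)
    from : (u , v) ≡ (a , b) ⊎ Row a (suc b) l (u , v) → Row a b (suc l) (u , v)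
    from (inj₁ refl)       = refl , Equivalence.from (inInterval-suc b l b) (inj₁ refl)
    from (inj₂ (u≡a , v∈)) = u≡a , Equivalence.from (inInterval-suc b l v) (inj₂ v∈)

HasSize-Rectangle : ∀ a k b l → HasSize (k * l) (Rectangle a k b l)
HasSize-Rectangle a zero    b l = HasSize-∅ λ { (u , v) (u∈ , _) → ¬InInterval-0 u∈ }
HasSize-Rectangle a (suc k) b l =
  HasSize-⇔ split (HasSize-⊎ disjoint (HasSize-Row a b l) (HasSize-Rectangle (suc a) k b l))
  where
  disjoint : ∀ {x} → Row a b l x → ¬ Rectangle (suc a) k b l x
  disjoint {u , v} (refl , _) ((a<a , _) , _) = <-irrefl refl a<a
  split : ∀ {u v} → Rectangle a (suc k) b l (u , v) ⇔ (Row a b l (u , v) ⊎ Rectangle (suc a) k b l (u , v))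
  split {u} {v} = mk⇔ to from
    where
    to : Rectangle a (suc k) b l (u , v) → Row a b l (u , v) ⊎ Rectangle (suc a) k b l (u , v)
    to (u∈ , v∈) with Equivalence.to (inInterval-suc a k u) u∈
    ... | inj₁ refl = inj₁ (refl , v∈)
    ... | inj₂ u∈′  = inj₂ (u∈′ , v∈)
    from : Row a b l (u , v) ⊎ Rectangle (suc a) k b l (u , v) → Rectangle a (suc k) b l (u , v)
    from (inj₁ (refl , v∈)) = Equivalence.from (inInterval-suc a k a) (inj₁ refl) , v∈
    from (inj₂ (u∈ , v∈))   = Equivalence.from (inInterval-suc a k u) (inj₂ u∈) , v∈

HasSize-Triangle : ∀ a k → HasSize (triangle k) (Triangle a k)
HasSize-Triangle a zero    =
  HasSize-∅ λ { (u , v) (a≤u , u<v , v<a+0) → ¬InInterval-0 (≤-trans a≤u (<⇒≤ u<v) , v<a+0) }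
HasSize-Triangle a (suc k) =
  HasSize-⇔ split (HasSize-⊎ disjoint (HasSize-Row a (suc a) k) (HasSize-Triangle (suc a) k))
  where
  disjoint : ∀ {x} → Row a (suc a) k x → ¬ Triangle (suc a) k x
  disjoint {u , v} (refl , _) (a<a , _) = <-irrefl refl a<a
  split : ∀ {u v} → Triangle a (suc k) (u , v) ⇔ (Row a (suc a) k (u , v) ⊎ Triangle (suc a) k (u , v))
  split {u} {v} = mk⇔ to from
    where
    to : Triangle a (suc k) (u , v) → Row a (suc a) k (u , v) ⊎ Triangle (suc a) k (u , v)
    to (a≤u , u<v , v<) with a ≟ u
    ... | yes refl = inj₁ (refl , u<v , <-+-suc a k v<)
    ... | no a≢u   = inj₂ (≤∧≢⇒< a≤u a≢u , u<v , <-+-suc a k v<)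
    from : Row a (suc a) k (u , v) ⊎ Triangle (suc a) k (u , v) → Triangle a (suc k) (u , v)
    from (inj₁ (refl , a<v , v<)) = ≤-refl , a<v , <-suc-+ a k v<
    from (inj₂ (a<u , u<v , v<))  = <⇒≤ a<u , u<v , <-suc-+ a k v<

-- The clique on [0, m) together with an edge from 0 to each vertex of [m, 2m), with every
-- pair of vertices listed once as u < v.
PendantCliqueEdge : ℕ → ℕ × ℕ → Set
PendantCliqueEdge m (u , v) = u < v × v < 2 * m × (u ≡ 0 ⊎ v < m)

PendantCliqueNonEdge : ℕ → ℕ × ℕ → Set
PendantCliqueNonEdge m (u , v) = 0 < u × u < v × m ≤ v × v < 2 * m

module _ {m : ℕ} .{{_ : NonZero m}} where

  private
    2*m≡m+m : 2 * m ≡ m + m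
    2*m≡m+m = cong (m +_) (+-identityʳ m)

    1+[m∸1]≡m : 1 + (m ∸ 1) ≡ m
    1+[m∸1]≡m = m+[n∸m]≡n (>-nonZero⁻¹ m)

  HasSize-PendantCliqueEdge : HasSize (triangle m + m) (PendantCliqueEdge m)
  HasSize-PendantCliqueEdge = HasSize-⇔ split
    (HasSize-⊎ (λ { (_ , _ , v<m) (_ , m≤v , _) → <-irrefl refl (<-≤-trans v<m m≤v) })
               (HasSize-Triangle 0 m) (HasSize-Row 0 m m))
    where
    split : ∀ {u v} → PendantCliqueEdge m (u , v) ⇔ (Triangle 0 m (u , v) ⊎ Row 0 m m (u , v))
    split {u} {v} = mk⇔ to from
      where
      to : PendantCliqueEdge m (u , v) → Triangle 0 m (u , v) ⊎ Row 0 m m (u , v)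
      to (u<v , v<2m , u≡0⊎v<m) with v <? m | u≡0⊎v<m
      ... | yes v<m | _        = inj₁ (z≤n , u<v , v<m)
      ... | no  v≮m | inj₁ u≡0 = inj₂ (u≡0 , ≮⇒≥ v≮m , subst (v <_) 2*m≡m+m v<2m)
      ... | no  v≮m | inj₂ v<m = contradiction v<m v≮m
      from : Triangle 0 m (u , v) ⊎ Row 0 m m (u , v) → PendantCliqueEdge m (u , v)
      from (inj₁ (_ , u<v , v<m))      = u<v , <-≤-trans v<m (m≤m+n m _) , inj₂ v<m
      from (inj₂ (refl , m≤v , v<m+m)) =
        <-≤-trans (>-nonZero⁻¹ m) m≤v , subst (v <_) (sym 2*m≡m+m) v<m+m , inj₁ refl

  HasSize-PendantCliqueNonEdge : HasSize ((m ∸ 1) * m + triangle m) (PendantCliqueNonEdge m)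
  HasSize-PendantCliqueNonEdge = HasSize-⇔ split
    (HasSize-⊎ (λ { ((_ , u<1+[m∸1]) , _) (m≤u , _) →
                      <-irrefl refl (<-≤-trans (subst (_ <_) 1+[m∸1]≡m u<1+[m∸1]) m≤u) })
               (HasSize-Rectangle 1 (m ∸ 1) m m) (HasSize-Triangle m m))
    where
    split : ∀ {u v} → PendantCliqueNonEdge m (u , v) ⇔ (Rectangle 1 (m ∸ 1) m m (u , v) ⊎ Triangle m m (u , v))
    split {u} {v} = mk⇔ to from
      where
      to : PendantCliqueNonEdge m (u , v) → Rectangle 1 (m ∸ 1) m m (u , v) ⊎ Triangle m m (u , v)
      to (0<u , u<v , m≤v , v<2m) with u <? m
      ... | yes u<m = inj₁ ((0<u , subst (u <_) (sym 1+[m∸1]≡m) u<m) , m≤v , subst (v <_) 2*m≡m+m v<2m)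
      ... | no  u≮m = inj₂ (≮⇒≥ u≮m , u<v , subst (v <_) 2*m≡m+m v<2m)
      from : Rectangle 1 (m ∸ 1) m m (u , v) ⊎ Triangle m m (u , v) → PendantCliqueNonEdge m (u , v)
      from (inj₁ ((0<u , u<1+[m∸1]) , m≤v , v<m+m)) =
        0<u , <-≤-trans (subst (u <_) 1+[m∸1]≡m u<1+[m∸1]) m≤v , m≤v , subst (v <_) (sym 2*m≡m+m) v<m+m
      from (inj₂ (m≤u , u<v , v<m+m)) =
        <-≤-trans (>-nonZero⁻¹ m) m≤u , u<v , <⇒≤ (≤-<-trans m≤u u<v) , subst (v <_) (sym 2*m≡m+m) v<m+m

triangle*2 : ∀ k → triangle k * 2 ≡ k * (k ∸ 1)
triangle*2 zero          = refl
triangle*2 (suc zero)    = refl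
triangle*2 (suc (suc j)) = begin
  (suc j + triangle (suc j)) * 2      ≡⟨ *-distribʳ-+ 2 (suc j) (triangle (suc j)) ⟩
  suc j * 2 + triangle (suc j) * 2    ≡⟨ cong (suc j * 2 +_) (triangle*2 (suc j)) ⟩
  suc j * 2 + suc j * j               ≡⟨ identity j ⟩
  suc (suc j) * suc j                 ∎
  where
  open ≡-Reasoning
  identity : ∀ j → suc j * 2 + suc j * j ≡ suc (suc j) * suc j
  identity = solve-∀

[triangle+k]*2 : ∀ k → (triangle k + k) * 2 ≡ k * (k + 1)
[triangle+k]*2 zero    = refl
[triangle+k]*2 (suc j) = begin
  (triangle (suc j) + suc j) * 2     ≡⟨ *-distribʳ-+ 2 (triangle (suc j)) (suc j) ⟩
  triangle (suc j) * 2 + suc j * 2   ≡⟨ cong (_+ suc j * 2) (triangle*2 (suc j)) ⟩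
  suc j * j + suc j * 2              ≡⟨ identity j ⟩
  suc j * (suc j + 1)                ∎
  where
  open ≡-Reasoning
  identity : ∀ j → suc j * j + suc j * 2 ≡ suc j * (suc j + 1)
  identity = solve-∀

[[k∸1]k+triangle]*2 : ∀ k → ((k ∸ 1) * k + triangle k) * 2 ≡ 3 * k * (k ∸ 1)
[[k∸1]k+triangle]*2 zero    = refl
[[k∸1]k+triangle]*2 (suc j) = begin
  (j * suc j + triangle (suc j)) * 2     ≡⟨ *-distribʳ-+ 2 (j * suc j) (triangle (suc j)) ⟩
  j * suc j * 2 + triangle (suc j) * 2   ≡⟨ cong (j * suc j * 2 +_) (triangle*2 (suc j)) ⟩
  j * suc j * 2 + suc j * j              ≡⟨ identity j ⟩
  3 * suc j * j                          ∎
  where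
  open ≡-Reasoning
  identity : ∀ j → j * suc j * 2 + suc j * j ≡ 3 * suc j * j
  identity = solve-∀

*2≡⇒≡/2 : ∀ {x y} → x * 2 ≡ y → x ≡ y / 2
*2≡⇒≡/2 {x} refl = sym (m*n/n≡m x 2)

-- Distances in power graphs

Dominating : ℕ → ℕ → Set
Dominating n w = ∀ {v} → InG n v → v ≢ w → Adj n w v

module _ {n : ℕ} where

  Adj-sym : ∀ {u v} → Adj n u v → Adj n v u
  Adj-sym (u∈ , v∈ , u≢v , power) = v∈ , u∈ , u≢v ∘ sym , [ inj₂ , inj₁ ]′ power

  walk-0 : ∀ {u v} → Walk n u v 0 → u ≡ v
  walk-0 (here _) = refl

  walk-1 : ∀ {u v} → Walk n u v 1 → Adj n u v
  walk-1 (step u~v (here _)) = u~v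

  atDist-0 : ∀ {u v} → AtDist n 0 (u , v) ⇔ Diagonal (2 ^ n) (u , v)
  atDist-0 {u} {v} = mk⇔ to from
    where
    to : AtDist n 0 (u , v) → Diagonal (2 ^ n) (u , v)
    to (_ , _ , v∈ , walk , _) = walk-0 walk , v∈
    from : Diagonal (2 ^ n) (u , v) → AtDist n 0 (u , v)
    from (refl , v∈) = ≤-refl , v∈ , v∈ , here v∈ , λ _ ()

  atDist-1 : ∀ {u v} → AtDist n 1 (u , v) ⇔ (u < v × Adj n u v)
  atDist-1 {u} {v} = mk⇔ to from
    where
    to : AtDist n 1 (u , v) → u < v × Adj n u v
    to (u≤v , _ , _ , walk , _) with u~v@(_ , _ , u≢v , _) ← walk-1 walk = ≤∧≢⇒< u≤v u≢v , u~v
    from : u < v × Adj n u v → AtDist n 1 (u , v)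
    from (u<v , u~v@(u∈ , v∈ , u≢v , _)) = <⇒≤ u<v , u∈ , v∈ , step u~v (here v∈) , shorter
      where
      shorter : ∀ j → j < 1 → ¬ Walk n u v j
      shorter zero    _ = u≢v ∘ walk-0
      shorter (suc _) (s≤s ())

  atDist-2 : ∀ {w} → Dominating n w → ∀ {u v} → AtDist n 2 (u , v) ⇔ (u < v × InG n v × ¬ Adj n u v)
  atDist-2 {w} dom {u} {v} = mk⇔ to from
    where
    to : AtDist n 2 (u , v) → u < v × InG n v × ¬ Adj n u v
    to (u≤v , _ , v∈ , _ , shorter) =
      ≤∧≢⇒< u≤v (λ { refl → shorter 0 z<s (here v∈) }) , v∈ , λ u~v → shorter 1 (s≤s z<s) (step u~v (here v∈))
    from : u < v × InG n v × ¬ Adj n u v → AtDist n 2 (u , v)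
    from (u<v , v∈ , u≁v) = <⇒≤ u<v , u∈ , v∈ , step (Adj-sym (dom u∈ u≢w)) (step (dom v∈ v≢w) (here v∈)) , shorter
      where
      u∈ : InG n u
      u∈ = <-trans u<v v∈
      u≢w : u ≢ w
      u≢w refl = u≁v (dom v∈ (λ { refl → <-irrefl refl u<v }))
      v≢w : v ≢ w
      v≢w refl = u≁v (Adj-sym (dom u∈ (<⇒≢ u<v)))
      shorter : ∀ j → j < 2 → ¬ Walk n u v j
      shorter zero          _ = <⇒≢ u<v ∘ walk-0
      shorter (suc zero)    _ = u≁v ∘ walk-1
      shorter (suc (suc _)) (s≤s (s≤s ()))

-- The gyrogroup G(n) and its power graph

if-⌊⌋-yes : ∀ {A P : Set} (P? : Dec P) {x y : A} → P → (if ⌊ P? ⌋ then x else y) ≡ x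
if-⌊⌋-yes (yes _) _  = refl
if-⌊⌋-yes (no ¬p) p = contradiction p ¬p

if-⌊⌋-no : ∀ {A P : Set} (P? : Dec P) {x y : A} → ¬ P → (if ⌊ P? ⌋ then x else y) ≡ y
if-⌊⌋-no (yes p) ¬p = contradiction p ¬p
if-⌊⌋-no (no _)  _  = refl

[k+1]h+[k∸1]h≡h*2k : ∀ k h → .{{NonZero k}} → (k + 1) * h + (k ∸ 1) * h ≡ h * (2 * k)
[k+1]h+[k∸1]h≡h*2k (suc w) h = identity w h
  where
  identity : ∀ w h → (suc w + 1) * h + w * h ≡ h * (2 * suc w)
  identity = solve-∀

module GyrogroupPowerGraph (p : ℕ) where

  n : ℕ
  n = suc (suc p)

  m : ℕ
  m = half n

  instance
    m≢0 : NonZero m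
    m≢0 = half-nonZero n

  0<m : 0 < m
  0<m = m^n>0 2 (suc p)

  m/2≡2^p : m / 2 ≡ 2 ^ p
  m/2≡2^p = trans (cong (_/ 2) (*-comm 2 (2 ^ p))) (m*n/n≡m (2 ^ p) 2)

  oplus-P : ∀ {a b} → a < m → b < m → oplus n a b ≡ (a + b) % m
  oplus-P {a} {b} a<m b<m = trans (if-⌊⌋-yes (a <? m) a<m) (if-⌊⌋-yes (b <? m) b<m)

  oplus-H-identityʳ : ∀ {h} → m ≤ h → h < 2 * m → oplus n h 0 ≡ h
  oplus-H-identityʳ {h} m≤h h<2m = begin
    oplus n h 0                     ≡⟨ trans (if-⌊⌋-no (h <? m) (≤⇒≯ m≤h)) (if-⌊⌋-yes (0 <? m) 0<m) ⟩
    (h + (m / 2 ∸ 1) * 0) % m + m   ≡⟨ cong (λ z → (h + z) % m + m) (*-zeroʳ (m / 2 ∸ 1)) ⟩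
    (h + 0) % m + m                 ≡⟨ cong (λ z → z % m + m) (+-identityʳ h) ⟩
    h % m + m                       ≡⟨ cong (_+ m) (m≤n⇒[n∸m]%m≡n%m m≤h) ⟨
    (h ∸ m) % m + m                 ≡⟨ cong (_+ m) (m<n⇒m%n≡m h∸m<m) ⟩
    h ∸ m + m                       ≡⟨ m∸n+n≡m m≤h ⟩
    h                               ∎
    where
    open ≡-Reasoning
    h∸m<m : h ∸ m < m
    h∸m<m = m<n+o⇒m∸n<o h m (subst (h <_) (cong (m +_) (+-identityʳ m)) h<2m)

  oplus-H-self : ∀ {h} → m ≤ h → oplus n h h ≡ 0
  oplus-H-self {h} m≤h = begin
    oplus n h h                               ≡⟨ trans (if-⌊⌋-no (h <? m) h≮m) (if-⌊⌋-no (h <? m) h≮m) ⟩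
    ((m / 2 + 1) * h + (m / 2 ∸ 1) * h) % m   ≡⟨ cong (λ k → ((k + 1) * h + (k ∸ 1) * h) % m) m/2≡2^p ⟩
    ((2 ^ p + 1) * h + (2 ^ p ∸ 1) * h) % m   ≡⟨ cong (_% m) ([k+1]h+[k∸1]h≡h*2k (2 ^ p) h {{m^n≢0 2 p}}) ⟩
    h * m % m                                 ≡⟨ m*n%n≡0 h m ⟩
    0                                         ∎
    where
    open ≡-Reasoning
    h≮m = ≤⇒≯ m≤h

  powS-P : ∀ {a} → a < m → ∀ k → powS n a k ≡ (suc k * a) % m
  powS-P {a} a<m zero    = sym (trans (cong (_% m) (+-identityʳ a)) (m<n⇒m%n≡m a<m))
  powS-P {a} a<m (suc k) = begin
    oplus n a (powS n a k)        ≡⟨ cong (oplus n a) (powS-P a<m k) ⟩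
    oplus n a ((suc k * a) % m)   ≡⟨ oplus-P a<m (m%n<n (suc k * a) m) ⟩
    (a + (suc k * a) % m) % m     ≡⟨ [m+n%d]%d≡[m+n]%d a (suc k * a) m ⟩
    (suc (suc k) * a) % m         ∎
    where open ≡-Reasoning

  powS-H : ∀ {h} → m ≤ h → h < 2 * m → ∀ k → powS n h k ≡ h ⊎ powS n h k ≡ 0
  powS-H m≤h h<2m zero    = inj₁ refl
  powS-H {h} m≤h h<2m (suc k) with powS-H m≤h h<2m k
  ... | inj₁ hᵏ≡h = inj₂ (trans (cong (oplus n h) hᵏ≡h) (oplus-H-self m≤h))
  ... | inj₂ hᵏ≡0 = inj₁ (trans (cong (oplus n h) hᵏ≡0) (oplus-H-identityʳ m≤h h<2m))

  -- Adding m to the multiplier makes the exponent positive without changing the power.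
  isPowerOf-P : ∀ {a b} t → a < m → b < m → (t * a) % m ≡ b % m → IsPowerOf n a b
  isPowerOf-P {a} {b} t a<m b<m ta≡b = t + pred m , (begin
    powS n a (t + pred m)       ≡⟨ powS-P a<m (t + pred m) ⟩
    (suc (t + pred m) * a) % m  ≡⟨ cong (λ z → (z * a) % m) (trans (sym (+-suc t (pred m))) (cong (t +_) (suc-pred m))) ⟩
    ((t + m) * a) % m           ≡⟨ cong (_% m) (trans (*-distribʳ-+ a t m) (cong (t * a +_) (*-comm m a))) ⟩
    (t * a + a * m) % m         ≡⟨ [m+kn]%n≡m%n (t * a) a m ⟩
    (t * a) % m                 ≡⟨ ta≡b ⟩
    b % m                       ≡⟨ m<n⇒m%n≡m b<m ⟩
    b                           ∎)
    where open ≡-Reasoning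

  isPowerOf-P-total : ∀ {a b} → a < m → b < m → IsPowerOf n a b ⊎ IsPowerOf n b a
  isPowerOf-P-total a<m b<m =
    Sum.map (λ (t , ta≡b) → isPowerOf-P t a<m b<m ta≡b) (λ (t , tb≡a) → isPowerOf-P t b<m a<m tb≡a)
            (multiples-total-mod-p^ prime[2] (suc p) _ _)

  isPowerOf-zero : ∀ {u} → InG n u → IsPowerOf n u 0
  isPowerOf-zero {u} u<2m with u <? m
  ... | yes u<m = isPowerOf-P 0 u<m 0<m refl
  ... | no  u≮m = 1 , oplus-H-self (≮⇒≥ u≮m)

  isPowerOf-cases : ∀ {u v} → InG n u → IsPowerOf n u v → (u < m × v < m) ⊎ v ≡ u ⊎ v ≡ 0
  isPowerOf-cases {u} u<2m (k , refl) with u <? m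
  ... | yes u<m = inj₁ (u<m , subst (_< m) (sym (powS-P u<m k)) (m%n<n (suc k * u) m))
  ... | no  u≮m = inj₂ (powS-H (≮⇒≥ u≮m) u<2m k)

  zero-dominating : Dominating n 0
  zero-dominating v∈ v≢0 = m^n>0 2 n , v∈ , v≢0 ∘ sym , inj₂ (isPowerOf-zero v∈)

  <⇒adj⇔ : ∀ {u v} → u < v → Adj n u v ⇔ (InG n v × (u ≡ 0 ⊎ v < m))
  <⇒adj⇔ {u} {v} u<v = mk⇔ to from
    where
    to : Adj n u v → InG n v × (u ≡ 0 ⊎ v < m)
    to (u∈ , v∈ , _ , inj₁ uᵏ≡v) with isPowerOf-cases u∈ uᵏ≡v
    ... | inj₁ (_ , v<m)   = v∈ , inj₂ v<m
    ... | inj₂ (inj₁ refl) = contradiction u<v (<-irrefl refl)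
    ... | inj₂ (inj₂ refl) = contradiction u<v λ ()
    to (_ , v∈ , _ , inj₂ vᵏ≡u) with isPowerOf-cases v∈ vᵏ≡u
    ... | inj₁ (v<m , _)   = v∈ , inj₂ v<m
    ... | inj₂ (inj₁ refl) = contradiction u<v (<-irrefl refl)
    ... | inj₂ (inj₂ u≡0)  = v∈ , inj₁ u≡0
    from : InG n v × (u ≡ 0 ⊎ v < m) → Adj n u v
    from (v∈ , inj₁ refl) = zero-dominating v∈ (>⇒≢ u<v)
    from (v∈ , inj₂ v<m)  = <-trans u<v v∈ , v∈ , <⇒≢ u<v , isPowerOf-P-total (<-trans u<v v<m) v<m

  atDist-1⇔PendantCliqueEdge : ∀ {u v} → AtDist n 1 (u , v) ⇔ PendantCliqueEdge m (u , v)
  atDist-1⇔PendantCliqueEdge {u} {v} = mk⇔ to from ⇔-∘ atDist-1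
    where
    to : u < v × Adj n u v → PendantCliqueEdge m (u , v)
    to (u<v , u~v) = u<v , Equivalence.to (<⇒adj⇔ u<v) u~v
    from : PendantCliqueEdge m (u , v) → u < v × Adj n u v
    from (u<v , linked) = u<v , Equivalence.from (<⇒adj⇔ u<v) linked

  atDist-2⇔PendantCliqueNonEdge : ∀ {u v} → AtDist n 2 (u , v) ⇔ PendantCliqueNonEdge m (u , v)
  atDist-2⇔PendantCliqueNonEdge {u} {v} = mk⇔ to from ⇔-∘ atDist-2 zero-dominating
    where
    to : u < v × InG n v × ¬ Adj n u v → PendantCliqueNonEdge m (u , v)
    to (u<v , v∈ , u≁v) =
      n≢0⇒n>0 (λ u≡0 → u≁v (Equivalence.from (<⇒adj⇔ u<v) (v∈ , inj₁ u≡0))) , u<v ,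
      ≮⇒≥ (λ v<m → u≁v (Equivalence.from (<⇒adj⇔ u<v) (v∈ , inj₂ v<m))) , v∈
    from : PendantCliqueNonEdge m (u , v) → u < v × InG n v × ¬ Adj n u v
    from (0<u , u<v , m≤v , v∈) = u<v , v∈ , λ u~v → case Equivalence.to (<⇒adj⇔ u<v) u~v of λ where
      (_ , inj₁ refl) → <-irrefl refl 0<u
      (_ , inj₂ v<m)  → <-irrefl refl (<-≤-trans v<m m≤v)

  dis-1 : dis≡ n 1 (triangle m + m)
  dis-1 = HasSize-⇔ atDist-1⇔PendantCliqueEdge HasSize-PendantCliqueEdge

  dis-2 : dis≡ n 2 ((m ∸ 1) * m + triangle m)
  dis-2 = HasSize-⇔ atDist-2⇔PendantCliqueNonEdge HasSize-PendantCliqueNonEdge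

lemma4p1 : (n : ℕ) → 3 ≤ n →
    dis≡ n 0 (2 ^ n)
    × dis≡ n 1 ((2 ^ (n ∸ 1) * (2 ^ (n ∸ 1) + 1)) / 2)
    × dis≡ n 2 ((3 * 2 ^ (n ∸ 1) * (2 ^ (n ∸ 1) ∸ 1)) / 2)
lemma4p1 n@(suc (suc (suc p))) (s≤s (s≤s (s≤s _))) =
  HasSize-⇔ atDist-0 (HasSize-Diagonal (2 ^ n)) ,
  subst (dis≡ n 1) (*2≡⇒≡/2 ([triangle+k]*2 m)) dis-1 ,
  subst (dis≡ n 2) (*2≡⇒≡/2 ([[k∸1]k+triangle]*2 m)) dis-2
  where open GyrogroupPowerGraph (suc p) using (m; dis-1; dis-2)
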